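{- Let $M=(m_i)_{i=0}^{\infty}$ be a sequence of integers with $m_0=1$ and $m_i\ge 2$ for $i\ge 1$, $M_i=\prod_{j=0}^{i}m_j$. Let $n=a_0+a_1M_1+\cdots+a_kM_k$ with $a_j\in\{0,\ldots,m_{j+1}-1\}$ be the $M$-ary representation of $n$. Then \[ b_M(n)\equiv\prod_{j=1}^{k}(a_j+1)\pmod{\gcd(m_1,\ldots,m_k)}. \]
   Context: $b_M(n)$ is the number of $M$-ary partitions of $n$, i.e. representations $n=M_{i_1}+\cdots+M_{i_r}$ with $i_1\le\cdots\le i_r$ (equivalently $b_M(n)=p_M(n,1)$ where $\prod_{i\ge0}\frac{1}{1-tq^{M_i}}=\sum_n p_M(n,t)q^n$). -}

module Defs where

open import Data.Nat using (ℕ; zero; suc; _+_; _*_; _∸_; _≤ᵇ_)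
open import Data.Bool using (if_then_else_)
open import Data.Nat.GCD using (gcd)
open import Data.List using (map; upTo)
open import Data.Nat.ListAction using (sum)
open import Data.Integer using (ℤ; +_; _-_)
open import Data.Integer.Divisibility using (_∣_)

bigM : (ℕ → ℕ) → ℕ → ℕ
bigM m zero    = m zero
bigM m (suc i) = bigM m i * m (suc i)

sumTo : (ℕ → ℕ) → ℕ → ℕ
sumTo f zero    = f zero
sumTo f (suc k) = sumTo f k + f (suc k)

prodFrom1 : (ℕ → ℕ) → ℕ → ℕ
prodFrom1 f zero    = 1
prodFrom1 f (suc k) = prodFrom1 f k * f (suc k)

gcdFrom1 : (ℕ → ℕ) → ℕ → ℕ
gcdFrom1 f zero    = 0
gcdFrom1 f (suc k) = gcd (gcdFrom1 f k) (f (suc k))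

-- restrictedCount P j n = number of multiplicity vectors (c_0,...,c_{j-1}) ∈ ℕ^j
-- with c_0 P_0 + ... + c_{j-1} P_{j-1} = n, i.e. the number of partitions of n
-- into parts from P_0,...,P_{j-1} (multiplicities c ≤ n suffice, since parts are ≥ 1
-- in our application).
restrictedCount : (ℕ → ℕ) → ℕ → ℕ → ℕ
restrictedCount P zero    zero    = 1
restrictedCount P zero    (suc n) = 0
restrictedCount P (suc j) n =
  sum (map (λ c → if c * P j ≤ᵇ n then restrictedCount P j (n ∸ c * P j) else 0)
           (upTo (suc n)))

-- b_M(n): number of M-ary partitions of n, i.e. partitions of n into parts
-- M_0, M_1, M_2, ...  Since M_i ≥ 2^i > n for i > n (under m_i ≥ 2), only
-- parts M_0,...,M_n can occur.
bM : (ℕ → ℕ) → ℕ → ℕ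
bM m n = restrictedCount (bigM m) (suc n) n

-- congruence modulo d (d = 0 means equality)
_≡_[mod_] : ℕ → ℕ → ℕ → Set
x ≡ y [mod d ] = (+ d) ∣ ((+ x) - (+ y))

{-# OPTIONS --safe #-}
-- Write R_j(n) for the number of partitions of n into parts M_0, …, M_{j-1}
-- (restrictedCount (bigM m) j n), N_j = a_0 M_0 + ⋯ + a_j M_j and Π_j = ∏_{t=1}^{j} (a_t + 1).
-- Sorting partitions by the multiplicity c of the part M_j gives, for r < M_j,
--   R_{j+1}(b M_j + r) = Σ_{c ≤ b} R_j((b − c) M_j + r),
-- so if every R_j(b′ M_j + r) is ≡ Y (mod d), then R_{j+1}(b M_j + r) ≡ (b + 1) Y.
-- As b M_{j+1} + N_j = (b m_{j+1} + a_j) M_j + N_{j-1}, induction on j gives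
-- R_{j+1}(b M_{j+1} + N_j) ≡ (b m_{j+1} + a_j + 1) Π_{j-1} ≡ Π_j when d divides m_2, …, m_{j+1};
-- for n = N_k itself there is no multiple of M_{k+1}, so m_2, …, m_k suffice.
-- Finally n < M_{k+1}, so parts beyond M_k never occur in b_M(n).
module Submission where

open import Defs
open import Data.Bool using (true; false; if_then_else_)
import Data.Integer as ℤ
open import Data.Integer.Divisibility.Signed
  using (divides; ∣ᵤ⇒∣; ∣⇒∣ᵤ; ∣m∣n⇒∣m+n; ∣m⇒∣-m; ∣n⇒∣m*n)
  renaming (_∣_ to _∣ℤ_)
import Data.Integer.Properties as ℤP
import Data.Integer.Tactic.RingSolver as ℤR
open import Data.List using ([_]; _++_; map; upTo)
open import Data.List.Properties using (map-++; upTo-∷ʳ)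
open import Data.Nat
open import Data.Nat.Divisibility using (_∣_; ∣-trans)
open import Data.Nat.GCD using (gcd[m,n]∣m; gcd[m,n]∣n)
open import Data.Nat.ListAction using (sum)
open import Data.Nat.ListAction.Properties using (sum-++)
open import Data.Nat.Properties
open import Data.Nat.Tactic.RingSolver using (solve-∀)
open import Data.Sum using (inj₁; inj₂)
open import Function using (_∘_)
open import Level using (0ℓ)
open import Relation.Binary.Bundles using (Setoid)
open import Relation.Binary.PropositionalEquality
  using (_≡_; refl; sym; trans; cong; cong₂; subst; module ≡-Reasoning)
open import Relation.Nullary using (contradiction)

private variable
  b c i j n q r x y z u v : ℕ
  f g m a : ℕ → ℕ

sumBelow : ℕ → (ℕ → ℕ) → ℕ
sumBelow n f = sum (map f (upTo n))

sumBelow-suc : ∀ n f → sumBelow (suc n) f ≡ sumBelow n f + f n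
sumBelow-suc n f = begin
  sum (map f (upTo (suc n)))            ≡⟨ cong (sum ∘ map f) (upTo-∷ʳ n) ⟨
  sum (map f (upTo n ++ [ n ]))         ≡⟨ cong sum (map-++ f (upTo n) [ n ]) ⟩
  sum (map f (upTo n) ++ [ f n ])       ≡⟨ sum-++ (map f (upTo n)) [ f n ] ⟩
  sumBelow n f + (f n + 0)              ≡⟨ cong (sumBelow n f +_) (+-identityʳ (f n)) ⟩
  sumBelow n f + f n                    ∎
  where open ≡-Reasoning

sumBelow-cong : ∀ n → (∀ c → c < n → f c ≡ g c) → sumBelow n f ≡ sumBelow n g
sumBelow-cong zero    f≡g = refl
sumBelow-cong {f} {g} (suc n) f≡g = begin
  sumBelow (suc n) f  ≡⟨ sumBelow-suc n f ⟩
  sumBelow n f + f n  ≡⟨ cong₂ _+_ (sumBelow-cong n (λ c c<n → f≡g c (m<n⇒m<1+n c<n))) (f≡g n ≤-refl) ⟩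
  sumBelow n g + g n  ≡⟨ sumBelow-suc n g ⟨
  sumBelow (suc n) g  ∎
  where open ≡-Reasoning

sumBelow-vanishing : b ≤ n → (∀ c → b ≤ c → c < n → f c ≡ 0) → sumBelow n f ≡ sumBelow b f
sumBelow-vanishing {b} {f = f} b≤n = go (≤⇒≤′ b≤n)
  where
  go : ∀ {n} → b ≤′ n → (∀ c → b ≤ c → c < n → f c ≡ 0) → sumBelow n f ≡ sumBelow b f
  go ≤′-refl _ = refl
  go {suc n} (≤′-step b≤′n) f≡0 = begin
    sumBelow (suc n) f  ≡⟨ sumBelow-suc n f ⟩
    sumBelow n f + f n  ≡⟨ cong (sumBelow n f +_) (f≡0 n (≤′⇒≤ b≤′n) ≤-refl) ⟩
    sumBelow n f + 0    ≡⟨ +-identityʳ _ ⟩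
    sumBelow n f        ≡⟨ go b≤′n (λ c b≤c c<n → f≡0 c b≤c (m<n⇒m<1+n c<n)) ⟩
    sumBelow b f        ∎
    where open ≡-Reasoning

module Congruence (d : ℕ) where
  open ℤ using (ℤ; +_; _-_; 0ℤ)

  -- Wrapping the congruence in a record lets Agda infer x and y from a proof of x ≈ y;
  -- the unfolded integer divisibility does not determine them.
  infix 4 _≈_
  record _≈_ (x y : ℕ) : Set where
    constructor mod
    field ≡[mod] : x ≡ y [mod d ]
  open _≈_ public

  private
    fromSigned : + d ∣ℤ (+ x - + y) → x ≈ y
    fromSigned p = mod (∣⇒∣ᵤ p)

    toSigned : x ≈ y → + d ∣ℤ (+ x - + y)
    toSigned p = ∣ᵤ⇒∣ (≡[mod] p)

  ≈-refl : x ≈ x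
  ≈-refl {x} = fromSigned (divides 0ℤ (ℤP.+-inverseʳ (+ x)))

  ≈-sym : x ≈ y → y ≈ x
  ≈-sym {x} {y} p = fromSigned (subst (+ d ∣ℤ_) (negate (+ x) (+ y)) (∣m⇒∣-m (toSigned p)))
    where
    negate : ∀ (X Y : ℤ) → ℤ.- (X - Y) ≡ Y - X
    negate = ℤR.solve-∀

  ≈-trans : x ≈ y → y ≈ z → x ≈ z
  ≈-trans {x} {y} {z} p q =
    fromSigned (subst (+ d ∣ℤ_) (telescope (+ x) (+ y) (+ z)) (∣m∣n⇒∣m+n (toSigned p) (toSigned q)))
    where
    telescope : ∀ (X Y Z : ℤ) → (X - Y) ℤ.+ (Y - Z) ≡ X - Z
    telescope = ℤR.solve-∀

  ≈-setoid : Setoid 0ℓ 0ℓ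
  ≈-setoid = record
    { Carrier = ℕ
    ; _≈_ = _≈_
    ; isEquivalence = record { refl = ≈-refl ; sym = ≈-sym ; trans = ≈-trans }
    }

  ≈-reflexive : x ≡ y → x ≈ y
  ≈-reflexive refl = ≈-refl

  +-cong : x ≈ y → u ≈ v → x + u ≈ y + v
  +-cong {x} {y} {u} {v} p q =
    fromSigned (subst (+ d ∣ℤ_) regroup (∣m∣n⇒∣m+n (toSigned p) (toSigned q)))
    where
    interchange : ∀ (X Y U V : ℤ) → (X - Y) ℤ.+ (U - V) ≡ (X ℤ.+ U) - (Y ℤ.+ V)
    interchange = ℤR.solve-∀
    regroup : (+ x - + y) ℤ.+ (+ u - + v) ≡ + (x + u) - + (y + v)
    regroup = trans (interchange (+ x) (+ y) (+ u) (+ v))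
                    (sym (cong₂ _-_ (ℤP.pos-+ x u) (ℤP.pos-+ y v)))

  k*q+z≈z : d ∣ q → ∀ k z → k * q + z ≈ z
  k*q+z≈z {q} d∣q k z = fromSigned (subst (+ d ∣ℤ_) difference (∣n⇒∣m*n (+ k) (∣ᵤ⇒∣ d∣q)))
    where
    cancel : ∀ (K Q Z : ℤ) → K ℤ.* Q ≡ (K ℤ.* Q ℤ.+ Z) - Z
    cancel = ℤR.solve-∀
    difference : + k ℤ.* + q ≡ + (k * q + z) - + z
    difference = trans (cancel (+ k) (+ q) (+ z))
                       (sym (cong (_- + z) (trans (ℤP.pos-+ (k * q) z) (cong (ℤ._+ + z) (ℤP.pos-* k q)))))

  sumBelow-≈ : ∀ n → (∀ c → c < n → f c ≈ y) → sumBelow n f ≈ n * y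
  sumBelow-≈ zero _ = ≈-refl
  sumBelow-≈ {f} {y} (suc n) f≈y = begin
    sumBelow (suc n) f  ≡⟨ sumBelow-suc n f ⟩
    sumBelow n f + f n  ≈⟨ +-cong (sumBelow-≈ n (λ c c<n → f≈y c (m<n⇒m<1+n c<n))) (f≈y n ≤-refl) ⟩
    n * y + y           ≡⟨ +-comm (n * y) y ⟩
    suc n * y           ∎
    where open import Relation.Binary.Reasoning.Setoid ≈-setoid

if-≤ᵇ-yes : ∀ {A : Set} {x y : A} → u ≤ v → (if u ≤ᵇ v then x else y) ≡ x
if-≤ᵇ-yes {u} {v} u≤v with u ≤ᵇ v | ≤⇒≤ᵇ u≤v
... | true | _ = refl

if-≤ᵇ-no : ∀ {A : Set} {x y : A} → v < u → (if u ≤ᵇ v then x else y) ≡ y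
if-≤ᵇ-no {v} {u} v<u with u ≤ᵇ v | ≤ᵇ⇒≤ u v
... | false | _   = refl
... | true  | u≤v = contradiction (u≤v _) (<⇒≱ v<u)

b*q+r<c*q : r < q → b < c → b * q + r < c * q
b*q+r<c*q {r} {q} {b} {c} r<q b<c = begin-strict
  b * q + r  <⟨ +-monoʳ-< (b * q) r<q ⟩
  b * q + q  ≡⟨ +-comm (b * q) q ⟩
  suc b * q  ≤⟨ *-monoˡ-≤ q b<c ⟩
  c * q      ∎
  where open ≤-Reasoning

restrictedCount-suc : ∀ P {j r} b → r < P j →
  restrictedCount P (suc j) (b * P j + r) ≡
  sumBelow (suc b) (λ c → restrictedCount P j ((b ∸ c) * P j + r))
restrictedCount-suc P {j} {r} b r<Q = begin
  sumBelow (suc N) term  ≡⟨ sumBelow-vanishing (s≤s b≤N) (λ c b<c _ → term-above b<c) ⟩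
  sumBelow (suc b) term  ≡⟨ sumBelow-cong (suc b) (λ c c≤b → term-below (≤-pred c≤b)) ⟩
  sumBelow (suc b) (λ c → restrictedCount P j ((b ∸ c) * Q + r)) ∎
  where
  open ≡-Reasoning
  Q N : ℕ
  Q = P j
  N = b * Q + r

  term : ℕ → ℕ
  term c = if c * Q ≤ᵇ N then restrictedCount P j (N ∸ c * Q) else 0

  term-below : ∀ {c} → c ≤ b → term c ≡ restrictedCount P j ((b ∸ c) * Q + r)
  term-below {c} c≤b =
    trans (if-≤ᵇ-yes (≤-trans cQ≤bQ (m≤m+n (b * Q) r))) (cong (restrictedCount P j) (begin
    b * Q + r ∸ c * Q    ≡⟨ +-∸-comm r cQ≤bQ ⟩
    (b * Q ∸ c * Q) + r  ≡⟨ cong (_+ r) (*-distribʳ-∸ Q b c) ⟨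
    (b ∸ c) * Q + r      ∎))
    where
    cQ≤bQ : c * Q ≤ b * Q
    cQ≤bQ = *-monoˡ-≤ Q c≤b

  term-above : ∀ {c} → b < c → term c ≡ 0
  term-above b<c = if-≤ᵇ-no (b*q+r<c*q r<Q b<c)

  b≤N : b ≤ N
  b≤N = ≤-trans (m≤m*n b Q {{>-nonZero (≤-<-trans z≤n r<Q)}}) (m≤m+n (b * Q) r)

restrictedCount-zero-> : ∀ P → 0 < n → restrictedCount P 0 n ≡ 0
restrictedCount-zero-> P (s≤s z≤n) = refl

restrictedCount-one : ∀ P → 0 < P 0 → ∀ b → restrictedCount P 1 (b * P 0) ≡ 1
restrictedCount-one P P₀>0 b = begin
  restrictedCount P 1 (b * P 0)      ≡⟨ cong (restrictedCount P 1) (+-identityʳ (b * P 0)) ⟨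
  restrictedCount P 1 (b * P 0 + 0)  ≡⟨ restrictedCount-suc P b P₀>0 ⟩
  sumBelow (suc b) term              ≡⟨ sumBelow-suc b term ⟩
  sumBelow b term + term b           ≡⟨ cong₂ _+_ (sumBelow-vanishing z≤n (λ c _ → term-below)) term-last ⟩
  0 + 1                              ∎
  where
  open ≡-Reasoning
  term : ℕ → ℕ
  term c = restrictedCount P 0 ((b ∸ c) * P 0 + 0)

  term-below : ∀ {c} → c < b → term c ≡ 0
  term-below c<b = restrictedCount-zero-> P (≤-trans (*-mono-≤ (m<n⇒0<n∸m c<b) P₀>0) (m≤m+n _ 0))

  term-last : term b ≡ 1
  term-last = cong (λ e → restrictedCount P 0 (e * P 0 + 0)) (n∸n≡0 b)

restrictedCount-suc-< : ∀ P → n < P j → restrictedCount P (suc j) n ≡ restrictedCount P j n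
restrictedCount-suc-< P n<Pj = trans (restrictedCount-suc P 0 n<Pj) (+-identityʳ _)

restrictedCount-stable : ∀ P {j n} → (∀ t → j ≤ t → n < P t) → ∀ {k} → j ≤ k →
  restrictedCount P k n ≡ restrictedCount P j n
restrictedCount-stable P {j} {n} n<P j≤k = go (≤⇒≤′ j≤k)
  where
  go : ∀ {k} → j ≤′ k → restrictedCount P k n ≡ restrictedCount P j n
  go ≤′-refl = refl
  go (≤′-step {k} j≤′k) = trans (restrictedCount-suc-< P (n<P k (≤′⇒≤ j≤′k))) (go j≤′k)

module _ {d : ℕ} where
  open Congruence d
  open import Relation.Binary.Reasoning.Setoid ≈-setoid

  restrictedCount-suc-≈ : ∀ P j → r < P j → (∀ b → restrictedCount P j (b * P j + r) ≈ y) →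
    ∀ b → restrictedCount P (suc j) (b * P j + r) ≈ suc b * y
  restrictedCount-suc-≈ {r} {y} P j r<Pj count≈ b = begin
    restrictedCount P (suc j) (b * P j + r)
      ≡⟨ restrictedCount-suc P b r<Pj ⟩
    sumBelow (suc b) (λ c → restrictedCount P j ((b ∸ c) * P j + r))
      ≈⟨ sumBelow-≈ (suc b) (λ c _ → count≈ (b ∸ c)) ⟩
    suc b * y ∎

bigM-mono-≤ : (∀ i → 0 < m (suc i)) → i ≤ j → bigM m i ≤ bigM m j
bigM-mono-≤ {m} {i} m>0 i≤j = go (≤⇒≤′ i≤j)
  where
  go : ∀ {j} → i ≤′ j → bigM m i ≤ bigM m j
  go ≤′-refl = ≤-refl
  go (≤′-step {j} i≤′j) = ≤-trans (go i≤′j) (m≤m*n (bigM m j) (m (suc j)) {{>-nonZero (m>0 j)}})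

i<bigM : 0 < m 0 → (∀ i → 2 ≤ m (suc i)) → ∀ i → i < bigM m i
i<bigM m₀>0 m≥2 zero = m₀>0
i<bigM {m} m₀>0 m≥2 (suc i) = begin-strict
  suc i                 ≤⟨ i<M ⟩
  bigM m i              <⟨ m<m+n (bigM m i) (≤-<-trans z≤n i<M) ⟩
  bigM m i + bigM m i   ≡⟨ double (bigM m i) ⟩
  bigM m i * 2          ≤⟨ *-monoʳ-≤ (bigM m i) (m≥2 i) ⟩
  bigM m i * m (suc i)  ∎
  where
  open ≤-Reasoning
  i<M : i < bigM m i
  i<M = i<bigM m₀>0 m≥2 i
  double : ∀ p → p + p ≡ p * 2
  double = solve-∀

mixedRadix-step-< : ∀ m j → x < bigM m j → y < m (suc j) → x + y * bigM m j < bigM m (suc j)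
mixedRadix-step-< {x} {y} m j x<M y<m = begin-strict
  x + y * bigM m j          ≡⟨ +-comm x (y * bigM m j) ⟩
  y * bigM m j + x          <⟨ b*q+r<c*q x<M y<m ⟩
  m (suc j) * bigM m j      ≡⟨ *-comm (m (suc j)) (bigM m j) ⟩
  bigM m j * m (suc j)      ∎
  where open ≤-Reasoning

mixedRadix-< : 0 < m 0 → ∀ k → (∀ t → t ≤ k → a t < m (suc t)) →
  sumTo (λ t → a t * bigM m t) k < bigM m (suc k)
mixedRadix-< {m} m₀>0 zero    a<m = mixedRadix-step-< m 0 m₀>0 (a<m 0 z≤n)
mixedRadix-< {m} m₀>0 (suc k) a<m =
  mixedRadix-step-< m (suc k) (mixedRadix-< m₀>0 k (λ t t≤k → a<m t (m≤n⇒m≤1+n t≤k))) (a<m (suc k) ≤-refl)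

gcdFrom1-∣ : ∀ f k {t} → 1 ≤ t → t ≤ k → gcdFrom1 f k ∣ f t
gcdFrom1-∣ f zero    (s≤s _) ()
gcdFrom1-∣ f (suc k) 1≤t t≤1+k with m≤n⇒m<n∨m≡n t≤1+k
... | inj₁ t<1+k = ∣-trans (gcd[m,n]∣m (gcdFrom1 f k) (f (suc k))) (gcdFrom1-∣ f k 1≤t (≤-pred t<1+k))
... | inj₂ refl  = gcd[m,n]∣n (gcdFrom1 f k) (f (suc k))

bM≡restrictedCount : ∀ k → 0 < m 0 → (∀ i → 2 ≤ m (suc i)) → n < bigM m (suc k) →
  bM m n ≡ restrictedCount (bigM m) (suc k) n
bM≡restrictedCount {m} {n} k m₀>0 m≥2 n<M = begin
  restrictedCount (bigM m) (suc n) n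
    ≡⟨ restrictedCount-stable (bigM m) n<M[≥1+n] (m≤m⊔n (suc n) (suc k)) ⟨
  restrictedCount (bigM m) (suc n ⊔ suc k) n
    ≡⟨ restrictedCount-stable (bigM m) n<M[≥1+k] (m≤n⊔m (suc n) (suc k)) ⟩
  restrictedCount (bigM m) (suc k) n ∎
  where
  open ≡-Reasoning
  n<M[≥1+n] : ∀ t → suc n ≤ t → n < bigM m t
  n<M[≥1+n] t n<t = <-trans n<t (i<bigM m₀>0 m≥2 t)
  n<M[≥1+k] : ∀ t → suc k ≤ t → n < bigM m t
  n<M[≥1+k] t k<t = <-≤-trans n<M (bigM-mono-≤ (λ i → <⇒≤ (m≥2 i)) k<t)

module _ {m a : ℕ → ℕ} {d : ℕ} (m₀>0 : 0 < m 0) where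
  open Congruence d
  open import Relation.Binary.Reasoning.Setoid ≈-setoid

  private
    P N Π : ℕ → ℕ
    P = bigM m
    N = sumTo (λ t → a t * P t)
    Π = prodFrom1 (λ t → a t + 1)

    shift-digit : ∀ b p q a → b * (p * q) + a * p ≡ (b * q + a) * p
    shift-digit = solve-∀
    shift-digit+ : ∀ b p q a n → b * (p * q) + (n + a * p) ≡ (b * q + a) * p + n
    shift-digit+ = solve-∀
    expand : ∀ b q a p → suc (b * q + a) * p ≡ (b * p) * q + p * (a + 1)
    expand = solve-∀
    suc-* : ∀ a p → suc a * p ≡ p * (a + 1)
    suc-* = solve-∀

  restrictedCount-multiple+digits-≈ : ∀ j →
    (∀ t → 2 ≤ t → t ≤ suc j → d ∣ m t) → (∀ t → t ≤ j → a t < m (suc t)) →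
    ∀ b → restrictedCount P (suc j) (b * P (suc j) + N j) ≈ Π j
  restrictedCount-multiple+digits-≈ zero _ _ b = ≈-reflexive (trans
    (cong (restrictedCount P 1) (shift-digit b (m 0) (m 1) (a 0)))
    (restrictedCount-one P m₀>0 (b * m 1 + a 0)))
  restrictedCount-multiple+digits-≈ (suc i) d∣m a<m b = begin
    restrictedCount P (2 + i) (b * P (2 + i) + N (1 + i))
      ≡⟨ cong (restrictedCount P (2 + i)) (shift-digit+ b (P (1 + i)) (m (2 + i)) (a (1 + i)) (N i)) ⟩
    restrictedCount P (2 + i) (b′ * P (1 + i) + N i)
      ≈⟨ restrictedCount-suc-≈ P (1 + i) (mixedRadix-< m₀>0 i a<m′)
           (restrictedCount-multiple+digits-≈ i d∣m′ a<m′) b′ ⟩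
    suc b′ * Π i
      ≡⟨ expand b (m (2 + i)) (a (1 + i)) (Π i) ⟩
    (b * Π i) * m (2 + i) + Π (1 + i)
      ≈⟨ k*q+z≈z (d∣m (2 + i) (s≤s (s≤s z≤n)) ≤-refl) (b * Π i) (Π (1 + i)) ⟩
    Π (1 + i) ∎
    where
    b′ : ℕ
    b′ = b * m (2 + i) + a (1 + i)
    d∣m′ : ∀ t → 2 ≤ t → t ≤ suc i → d ∣ m t
    d∣m′ t 2≤t t≤1+i = d∣m t 2≤t (m≤n⇒m≤1+n t≤1+i)
    a<m′ : ∀ t → t ≤ i → a t < m (suc t)
    a<m′ t t≤i = a<m t (m≤n⇒m≤1+n t≤i)

  restrictedCount-digits-≈ : ∀ k →
    (∀ t → 2 ≤ t → t ≤ k → d ∣ m t) → (∀ t → t ≤ k → a t < m (suc t)) →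
    restrictedCount P (suc k) (N k) ≈ Π k
  restrictedCount-digits-≈ zero _ _ = ≈-reflexive (restrictedCount-one P m₀>0 (a 0))
  restrictedCount-digits-≈ (suc i) d∣m a<m = begin
    restrictedCount P (2 + i) (N i + a (1 + i) * P (1 + i))
      ≡⟨ cong (restrictedCount P (2 + i)) (+-comm (N i) (a (1 + i) * P (1 + i))) ⟩
    restrictedCount P (2 + i) (a (1 + i) * P (1 + i) + N i)
      ≈⟨ restrictedCount-suc-≈ P (1 + i) (mixedRadix-< m₀>0 i a<m′)
           (restrictedCount-multiple+digits-≈ i d∣m a<m′) (a (1 + i)) ⟩
    suc (a (1 + i)) * Π i
      ≡⟨ suc-* (a (1 + i)) (Π i) ⟩
    Π (1 + i) ∎
    where
    a<m′ : ∀ t → t ≤ i → a t < m (suc t)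
    a<m′ t t≤i = a<m t (m≤n⇒m≤1+n t≤i)

corollary5p5 : (m : ℕ → ℕ) → m 0 ≡ 1 → (∀ i → 1 ≤ i → 2 ≤ m i) →
    (n k : ℕ) (a : ℕ → ℕ) → (∀ j → j ≤ k → a j < m (suc j)) →
    n ≡ sumTo (λ j → a j * bigM m j) k →
    bM m n ≡ prodFrom1 (λ j → a j + 1) k [mod gcdFrom1 m k ]
corollary5p5 m m₀≡1 m≥2 n k a a<m refl = ≡[mod] (begin
  bM m n                              ≡⟨ bM≡restrictedCount k m₀>0 m[1+i]≥2 (mixedRadix-< m₀>0 k a<m) ⟩
  restrictedCount (bigM m) (suc k) n  ≈⟨ restrictedCount-digits-≈ m₀>0 k gcd∣m a<m ⟩
  prodFrom1 (λ j → a j + 1) k         ∎)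
  where
  open Congruence (gcdFrom1 m k)
  open import Relation.Binary.Reasoning.Setoid ≈-setoid
  m₀>0 : 0 < m 0
  m₀>0 = ≤-reflexive (sym m₀≡1)
  m[1+i]≥2 : ∀ i → 2 ≤ m (suc i)
  m[1+i]≥2 i = m≥2 (suc i) (s≤s z≤n)
  gcd∣m : ∀ t → 2 ≤ t → t ≤ k → gcdFrom1 m k ∣ m t
  gcd∣m t 2≤t t≤k = gcdFrom1-∣ m k (<⇒≤ 2≤t) t≤k
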